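{- Let $R$ be a Riesz space with strong unit, $f\in R$ and $b$ a rational with $0\le f\le b$, and let $0=s_0<s_1<\dots<s_n=b$ be a partition of $[0,b]$ by rationals. Then $$\sum_{i<n}s_i\,(s_i<f<s_{i+1})\ \le\ f\ \le\ \sum_{i<n}s_{i+1}\,(s_i\le f\le s_{i+1}).$$
   Context: A Riesz space is a $\mathbb{Q}$-vector space with a compatible lattice order; $1$ is a strong unit if every $x$ satisfies $-n1\le x\le n1$ for some $n$; rationals $r$ are identified with $r1$. $\mathrm{Spec}(R)$ is the distributive lattice generated by symbols $D(a)$, $a\in R$, subject to $D(1)=1$, $D(a)\wedge D(-a)=0$, $D(a+b)\le D(a)\vee D(b)$, $D(a)=0$ if $a\le0$, $D(a\vee b)=D(a)\vee D(b)$; $B$ is the Boolean algebra freely generated by it. $(f>r)=D(f-r)$, $(f<r)=D(r-f)$, $(r<f<s)=(f>r)\wedge(f<s)$; $(f\le r)$ and $(r\le f)$ are the complements in $B$ of $(f>r)$ and $(f<r)$; $(r\le f\le s)=(r\le f)\wedge(f\le s)$. A simple function is a finite formal sum $\sum_ir_ix_i$ with $x_i\in B$ and $r_i$ nonnegative rationals; $x_I=\bigwedge_{i\in I}x_i$ ($x_\emptyset=1$), $r_I=\sum_{i\in I}r_i$. Relations: $\sum_ir_ix_i\le f$ iff for every subset $I$ of the index set, $x_I\le(r_I\le f)$; $f\le\sum_js_jy_j$ iff $1=\bigvee_J((f\le s_J)\wedge y_J)$. -}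

module Defs where

open import Level using (Level; _⊔_) renaming (suc to lsuc)
open import Data.Nat using (ℕ; zero; suc)
open import Data.Fin using (Fin; zero; suc; inject₁; fromℕ)
open import Data.Bool using (Bool; true; false)
open import Data.Vec using (Vec; []; _∷_)
open import Data.Product using (_×_; _,_; ∃)
open import Data.Rational using (ℚ; 0ℚ; 1ℚ)
  renaming (_+_ to _+ℚ_; _*_ to _*ℚ_; _≤_ to _≤ℚ_)
open import Data.Integer using (+_)
import Data.Rational as Q
open import Relation.Binary.PropositionalEquality using (_≡_)
open import Relation.Binary.Structures using (IsPartialOrder)
open import Relation.Binary.Lattice.Definitions using (Supremum; Infimum)
open import Algebra.Structures using (IsAbelianGroup)

record RieszSpace (a : Level) : Set (lsuc a) where
  infixl 6 _+_
  infixl 7 _·_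
  infix 4 _≤_
  field
    Carrier : Set a
    _+_     : Carrier → Carrier → Carrier
    0#      : Carrier
    -_      : Carrier → Carrier
    _·_     : ℚ → Carrier → Carrier
    _≤_     : Carrier → Carrier → Set a
    _∨_     : Carrier → Carrier → Carrier
    _∧_     : Carrier → Carrier → Carrier
    +-isAbelianGroup : IsAbelianGroup _≡_ _+_ 0# -_
    ·-distrib-+ᴿ : ∀ r x y → r · (x + y) ≡ r · x + r · y
    ·-distrib-+ℚ : ∀ r s x → (r +ℚ s) · x ≡ r · x + s · x
    ·-assoc      : ∀ r s x → (r *ℚ s) · x ≡ r · (s · x)
    ·-identity   : ∀ x → 1ℚ · x ≡ x
    ≤-isPartialOrder : IsPartialOrder _≡_ _≤_
    ∨-supremum : Supremum _≤_ _∨_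
    ∧-infimum  : Infimum _≤_ _∧_
    +-mono-≤ : ∀ {x y} z → x ≤ y → x + z ≤ y + z
    ·-mono-≤ : ∀ {x y} r → 0ℚ ≤ℚ r → x ≤ y → r · x ≤ r · y
    𝟙 : Carrier
    strongUnit : ∀ x → ∃ λ (n : ℕ) →
      (- ((+ n Q./ 1) · 𝟙) ≤ x) × (x ≤ (+ n Q./ 1) · 𝟙)

module Spec {a : Level} (R : RieszSpace a) where
  open RieszSpace R public

  _-_ : Carrier → Carrier → Carrier
  x - y = x + (- y)

  ⟦_⟧ : ℚ → Carrier
  ⟦ r ⟧ = r · 𝟙

  -- Spec(R): the distributive lattice presented by generators D(a)
  -- and the relations of the paper.  Elements are terms; the order is
  -- the inductively generated preorder (equality = order both ways).

  infixr 7 _⊓_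
  infixr 6 _⊔ˡ_
  data LTerm : Set a where
    D     : Carrier → LTerm
    ⊤ˡ ⊥ˡ : LTerm
    _⊓_   : LTerm → LTerm → LTerm
    _⊔ˡ_  : LTerm → LTerm → LTerm

  infix 4 _≤ˡ_
  data _≤ˡ_ : LTerm → LTerm → Set a where
    refl  : ∀ {x} → x ≤ˡ x
    trans : ∀ {x y z} → x ≤ˡ y → y ≤ˡ z → x ≤ˡ z
    ⊥-min : ∀ {x} → ⊥ˡ ≤ˡ x
    ⊤-max : ∀ {x} → x ≤ˡ ⊤ˡ
    ⊓-lb₁ : ∀ {x y} → x ⊓ y ≤ˡ x
    ⊓-lb₂ : ∀ {x y} → x ⊓ y ≤ˡ y
    ⊓-glb : ∀ {x y z} → z ≤ˡ x → z ≤ˡ y → z ≤ˡ x ⊓ y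
    ⊔-ub₁ : ∀ {x y} → x ≤ˡ x ⊔ˡ y
    ⊔-ub₂ : ∀ {x y} → y ≤ˡ x ⊔ˡ y
    ⊔-lub : ∀ {x y z} → x ≤ˡ z → y ≤ˡ z → x ⊔ˡ y ≤ˡ z
    distrib : ∀ {x y z} → x ⊓ (y ⊔ˡ z) ≤ˡ (x ⊓ y) ⊔ˡ (x ⊓ z)
    D-unit : ⊤ˡ ≤ˡ D 𝟙
    D-neg  : ∀ x → D x ⊓ D (- x) ≤ˡ ⊥ˡ
    D-add  : ∀ x y → D (x + y) ≤ˡ D x ⊔ˡ D y
    D-nonpos : ∀ x → x ≤ 0# → D x ≤ˡ ⊥ˡ
    D-∨₁ : ∀ x y → D (x ∨ y) ≤ˡ D x ⊔ˡ D y
    D-∨₂ : ∀ x y → D x ⊔ˡ D y ≤ˡ D (x ∨ y)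

  -- B: the Boolean algebra freely generated by the lattice Spec(R),
  -- i.e. presented by a lattice homomorphism ι : Spec(R) → B.

  infixr 7 _∧ᴮ_
  infixr 6 _∨ᴮ_
  data BTerm : Set a where
    ι     : LTerm → BTerm
    ⊤ ⊥   : BTerm
    _∧ᴮ_  : BTerm → BTerm → BTerm
    _∨ᴮ_  : BTerm → BTerm → BTerm
    ¬_    : BTerm → BTerm

  infix 4 _≤ᴮ_
  data _≤ᴮ_ : BTerm → BTerm → Set a where
    refl  : ∀ {x} → x ≤ᴮ x
    trans : ∀ {x y z} → x ≤ᴮ y → y ≤ᴮ z → x ≤ᴮ z
    ⊥-min : ∀ {x} → ⊥ ≤ᴮ x
    ⊤-max : ∀ {x} → x ≤ᴮ ⊤
    ∧-lb₁ : ∀ {x y} → x ∧ᴮ y ≤ᴮ x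
    ∧-lb₂ : ∀ {x y} → x ∧ᴮ y ≤ᴮ y
    ∧-glb : ∀ {x y z} → z ≤ᴮ x → z ≤ᴮ y → z ≤ᴮ x ∧ᴮ y
    ∨-ub₁ : ∀ {x y} → x ≤ᴮ x ∨ᴮ y
    ∨-ub₂ : ∀ {x y} → y ≤ᴮ x ∨ᴮ y
    ∨-lub : ∀ {x y z} → x ≤ᴮ z → y ≤ᴮ z → x ∨ᴮ y ≤ᴮ z
    distrib : ∀ {x y z} → x ∧ᴮ (y ∨ᴮ z) ≤ᴮ (x ∧ᴮ y) ∨ᴮ (x ∧ᴮ z)
    compl₁  : ∀ {x} → x ∧ᴮ (¬ x) ≤ᴮ ⊥
    compl₂  : ∀ {x} → ⊤ ≤ᴮ x ∨ᴮ (¬ x)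
    ¬-anti  : ∀ {x y} → x ≤ᴮ y → ¬ y ≤ᴮ ¬ x
    ι-mono : ∀ {x y} → x ≤ˡ y → ι x ≤ᴮ ι y
    ι-⊤    : ⊤ ≤ᴮ ι ⊤ˡ
    ι-⊥    : ι ⊥ˡ ≤ᴮ ⊥
    ι-⊓    : ∀ {x y} → ι x ∧ᴮ ι y ≤ᴮ ι (x ⊓ y)
    ι-⊔    : ∀ {x y} → ι (x ⊔ˡ y) ≤ᴮ ι x ∨ᴮ ι y

  _>ᵇ_ : Carrier → ℚ → BTerm
  f >ᵇ r = ι (D (f - ⟦ r ⟧))

  _<ᵇ_ : Carrier → ℚ → BTerm
  f <ᵇ r = ι (D (⟦ r ⟧ - f))

  _≤ᵇ_ : Carrier → ℚ → BTerm
  f ≤ᵇ r = ¬ (f >ᵇ r)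

  _≤ᵇ'_ : ℚ → Carrier → BTerm
  r ≤ᵇ' f = ¬ (f <ᵇ r)

  ⟨_<_<_⟩ : ℚ → Carrier → ℚ → BTerm
  ⟨ r < f < s ⟩ = (f >ᵇ r) ∧ᴮ (f <ᵇ s)

  ⟨_≤_≤_⟩ : ℚ → Carrier → ℚ → BTerm
  ⟨ r ≤ f ≤ s ⟩ = (r ≤ᵇ' f) ∧ᴮ (f ≤ᵇ s)

  -- Simple functions Σ_i r_i x_i, indexed by Fin n; subsets of the
  -- index set are Vec Bool n (true = member).

  Simple : ℕ → Set a
  Simple n = Vec (ℚ × BTerm) n

  Subset : ℕ → Set
  Subset n = Vec Bool n

  meetSub : ∀ {n} → Simple n → Subset n → BTerm
  meetSub [] [] = ⊤
  meetSub ((r , x) ∷ S) (true ∷ I) = x ∧ᴮ meetSub S I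
  meetSub ((r , x) ∷ S) (false ∷ I) = meetSub S I

  sumSub : ∀ {n} → Simple n → Subset n → ℚ
  sumSub [] [] = 0ℚ
  sumSub ((r , x) ∷ S) (true ∷ I) = r +ℚ sumSub S I
  sumSub ((r , x) ∷ S) (false ∷ I) = sumSub S I

  ⋁Sub : ∀ n → (Subset n → BTerm) → BTerm
  ⋁Sub zero g = g []
  ⋁Sub (suc n) g = ⋁Sub n (λ I → g (false ∷ I)) ∨ᴮ ⋁Sub n (λ I → g (true ∷ I))

  -- Σ r_i x_i ≤ f  iff  ∀ I, x_I ≤ (r_I ≤ f)
  _≼_ : ∀ {n} → Simple n → Carrier → Set a
  S ≼ f = ∀ I → meetSub S I ≤ᴮ (sumSub S I ≤ᵇ' f)

  -- f ≤ Σ s_j y_j  iff  1 = ⋁_J ((f ≤ s_J) ∧ y_J)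
  _≼'_ : ∀ {n} → Carrier → Simple n → Set a
  _≼'_ {n} f S = ⊤ ≤ᴮ ⋁Sub n (λ J → (f ≤ᵇ sumSub S J) ∧ᴮ meetSub S J)

-- The intervals (sᵢ, sᵢ₊₁) are pairwise disjoint, so for the lower sum the meet x_I vanishes
-- as soon as I has two elements; for I = {i} it lies below (f > sᵢ) ≤ (sᵢ ≤ f), and for
-- I = ∅ the claim is 0 ≤ f.  For the upper sum, walk along the partition: starting from
-- s₀ ≤ f ≤ sₙ, either f ≤ s₁, and the singleton J = {0} covers, or s₁ < f ≤ sₙ and one
-- recurses on the shorter partition.  The only order-theoretic input is that (f > r) is
-- antitone in r, which needs 0 ≤ 𝟙.

module Submission where

open import Level using (Level)
open import Function using (_∘_)
open import Data.Nat using (ℕ; zero; suc)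
open import Data.Fin using (Fin; zero; suc; inject₁; fromℕ)
open import Data.Fin.Subset using () renaming (⊥ to ∅)
open import Data.Vec using (tabulate; []; _∷_)
open import Data.Product using (_,_; _×_)
open import Data.Sum using (_⊎_; inj₁; inj₂; map₂)
open import Data.Bool using (true; false)
import Data.Integer as ℤ
open import Data.Rational using (ℚ; 0ℚ; 1ℚ; _<_; _/_; 1/_; NonZero; Positive)
  renaming (_+_ to _+ℚ_; _*_ to _*ℚ_; _≤_ to _≤ℚ_; -_ to -ℚ_)
import Data.Rational.Properties as ℚ
open import Relation.Binary.PropositionalEquality as ≡
  using (_≡_; refl; sym; cong; subst; subst₂; module ≡-Reasoning)
open import Algebra.Bundles using (AbelianGroup)
import Algebra.Properties.AbelianGroup as AbelianGroupProperties
open import Algebra.Properties.Group ℚ.+-0-group using ()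
  renaming (\\-leftDividesˡ to p+[-p+q]≡q)

open import Defs

Ascending : ∀ {n} → (Fin (suc n) → ℚ) → Set
Ascending {n} s = ∀ (i : Fin n) → s (inject₁ i) ≤ℚ s (suc i)

module Properties {a : Level} (R : RieszSpace a) where
  open Spec R

  +-abelianGroup : AbelianGroup a a
  +-abelianGroup = record { isAbelianGroup = +-isAbelianGroup }

  open AbelianGroup +-abelianGroup using (comm; identityˡ; identityʳ; inverseˡ; inverseʳ)
  open AbelianGroupProperties +-abelianGroup
    using (\\-leftDividesˡ; //-rightDividesˡ; //-rightDividesʳ; ⁻¹-anti-homo‿-)

  x≡x+x⇒x≡0 : ∀ {x} → x ≡ x + x → x ≡ 0#
  x≡x+x⇒x≡0 {x} x≡x+x = begin
    x           ≡⟨ //-rightDividesʳ x x ⟨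
    (x + x) - x ≡⟨ cong (_- x) x≡x+x ⟨
    x - x       ≡⟨ inverseʳ x ⟩
    0#          ∎
    where open ≡-Reasoning

  ·-zeroʳ : ∀ r → r · 0# ≡ 0#
  ·-zeroʳ r = x≡x+x⇒x≡0 (≡.trans (cong (r ·_) (sym (identityˡ 0#))) (·-distrib-+ᴿ r 0# 0#))

  ·-zeroˡ : ∀ x → 0ℚ · x ≡ 0#
  ·-zeroˡ x = x≡x+x⇒x≡0 (≡.trans (cong (_· x) (sym (ℚ.+-identityʳ 0ℚ))) (·-distrib-+ℚ 0ℚ 0ℚ x))

  +-monoʳ-≤ : ∀ z {x y} → x ≤ y → z + x ≤ z + y
  +-monoʳ-≤ z {x} {y} x≤y = subst₂ _≤_ (comm x z) (comm y z) (+-mono-≤ z x≤y)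

  x≤y⇒x-y≤0 : ∀ {x y} → x ≤ y → x - y ≤ 0#
  x≤y⇒x-y≤0 {x} {y} x≤y = subst (x - y ≤_) (inverseʳ y) (+-mono-≤ (- y) x≤y)

  -‿antimono : ∀ {x y} → x ≤ y → - y ≤ - x
  -‿antimono {x} {y} x≤y =
    subst₂ _≤_ (\\-leftDividesˡ x (- y)) y+[-x-y]≡-x (+-mono-≤ (- x + - y) x≤y)
    where
    y+[-x-y]≡-x : y + (- x + - y) ≡ - x
    y+[-x-y]≡-x = ≡.trans (cong (y +_) (comm (- x) (- y))) (\\-leftDividesˡ y (- x))

  -- The strong-unit bound for -𝟙 gives -𝟙 ≤ c·𝟙 with c ≥ 0, i.e. 0 ≤ (c + 1)·𝟙.
  0≤𝟙 : 0# ≤ 𝟙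
  0≤𝟙 with strongUnit (- 𝟙)
  ... | n , _ , -𝟙≤c𝟙 = subst₂ _≤_ (·-zeroʳ (1/ k)) k⁻¹k𝟙≡𝟙 (·-mono-≤ (1/ k) 0≤k⁻¹ 0≤k𝟙)
    where
    c k : ℚ
    c = ℤ.+ n / 1
    k = c +ℚ 1ℚ
    instance
      k-positive : Positive k
      k-positive = ℚ.nonNeg+pos⇒pos c {{ℚ.normalize-nonNeg n 1}} 1ℚ
      k-nonZero : NonZero k
      k-nonZero = ℚ.pos⇒nonZero k
    0≤k⁻¹ : 0ℚ ≤ℚ 1/ k
    0≤k⁻¹ = ℚ.nonNegative⁻¹ (1/ k) {{ℚ.pos⇒nonNeg (1/ k) {{ℚ.1/pos⇒pos k}}}}
    0≤k𝟙 : 0# ≤ k · 𝟙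
    0≤k𝟙 = subst₂ _≤_ (inverseˡ 𝟙)
      (≡.trans (cong (c · 𝟙 +_) (sym (·-identity 𝟙))) (sym (·-distrib-+ℚ c 1ℚ 𝟙)))
      (+-mono-≤ 𝟙 -𝟙≤c𝟙)
    k⁻¹k𝟙≡𝟙 : 1/ k · (k · 𝟙) ≡ 𝟙
    k⁻¹k𝟙≡𝟙 = begin
      1/ k · (k · 𝟙)     ≡⟨ ·-assoc (1/ k) k 𝟙 ⟨
      (1/ k *ℚ k) · 𝟙   ≡⟨ cong (_· 𝟙) (ℚ.*-inverseˡ k) ⟩
      1ℚ · 𝟙             ≡⟨ ·-identity 𝟙 ⟩
      𝟙                  ∎
      where open ≡-Reasoning

  ⟦⟧-mono : ∀ {p q} → p ≤ℚ q → ⟦ p ⟧ ≤ ⟦ q ⟧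
  ⟦⟧-mono {p} {q} p≤q =
    subst₂ _≤_ (identityʳ ⟦ p ⟧) ⟦p⟧+⟦d⟧≡⟦q⟧ (+-monoʳ-≤ ⟦ p ⟧ 0≤⟦d⟧)
    where
    d : ℚ
    d = -ℚ p +ℚ q
    0≤⟦d⟧ : 0# ≤ ⟦ d ⟧
    0≤⟦d⟧ = subst (_≤ ⟦ d ⟧) (·-zeroʳ d)
      (·-mono-≤ d (subst (_≤ℚ d) (ℚ.+-inverseˡ p) (ℚ.+-monoʳ-≤ (-ℚ p) p≤q)) 0≤𝟙)
    ⟦p⟧+⟦d⟧≡⟦q⟧ : ⟦ p ⟧ + ⟦ d ⟧ ≡ ⟦ q ⟧
    ⟦p⟧+⟦d⟧≡⟦q⟧ = ≡.trans (sym (·-distrib-+ℚ p d 𝟙)) (cong ⟦_⟧ (p+[-p+q]≡q p q))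

  D-mono : ∀ {x y} → x ≤ y → D x ≤ˡ D y
  D-mono {x} {y} x≤y =
    trans (subst (λ z → D z ≤ˡ D (x - y) ⊔ˡ D y) (//-rightDividesˡ y x) (D-add (x - y) y))
          (⊔-lub (trans (D-nonpos (x - y) (x≤y⇒x-y≤0 x≤y)) ⊥-min) refl)

  >ᵇ-antitone : ∀ f {p q} → p ≤ℚ q → f >ᵇ q ≤ᴮ f >ᵇ p
  >ᵇ-antitone f p≤q = ι-mono (D-mono (+-monoʳ-≤ f (-‿antimono (⟦⟧-mono p≤q))))

  ≤-split : ∀ {x} y → x ≤ᴮ (x ∧ᴮ y) ∨ᴮ (x ∧ᴮ ¬ y)
  ≤-split y = trans (∧-glb refl (trans ⊤-max compl₂)) distrib

  x∧y≤⊥⇒x≤¬y : ∀ {x y} → x ∧ᴮ y ≤ᴮ ⊥ → x ≤ᴮ ¬ y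
  x∧y≤⊥⇒x≤¬y x∧y≤⊥ = trans (≤-split _) (∨-lub (trans x∧y≤⊥ ⊥-min) ∧-lb₂)

  x≤⊥⇒⊤≤¬x : ∀ {x} → x ≤ᴮ ⊥ → ⊤ ≤ᴮ ¬ x
  x≤⊥⇒⊤≤¬x x≤⊥ = trans compl₂ (∨-lub (trans x≤⊥ ⊥-min) refl)

  ¬¬-elim : ∀ {x} → ¬ ¬ x ≤ᴮ x
  ¬¬-elim {x} = trans (≤-split x) (∨-lub ∧-lb₂ (trans (∧-glb ∧-lb₂ ∧-lb₁) (trans compl₁ ⊥-min)))

  >ᵇ∧<ᵇ≤⊥ : ∀ f r → (f >ᵇ r) ∧ᴮ (f <ᵇ r) ≤ᴮ ⊥
  >ᵇ∧<ᵇ≤⊥ f r = subst (λ y → ι (D (f - ⟦ r ⟧)) ∧ᴮ ι (D y) ≤ᴮ ⊥) (⁻¹-anti-homo‿- f ⟦ r ⟧)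
                      (trans ι-⊓ (trans (ι-mono (D-neg (f - ⟦ r ⟧))) ι-⊥))

  >ᵇ⇒≤ᵇ' : ∀ f r → f >ᵇ r ≤ᴮ r ≤ᵇ' f
  >ᵇ⇒≤ᵇ' f r = x∧y≤⊥⇒x≤¬y (>ᵇ∧<ᵇ≤⊥ f r)

  x≤y⇒⊤≤¬D[x-y] : ∀ {x y} → x ≤ y → ⊤ ≤ᴮ ¬ ι (D (x - y))
  x≤y⇒⊤≤¬D[x-y] x≤y = x≤⊥⇒⊤≤¬x (trans (ι-mono (D-nonpos _ (x≤y⇒x-y≤0 x≤y))) ι-⊥)

  ⋁Sub-ub : ∀ n (g : Subset n → BTerm) I → g I ≤ᴮ ⋁Sub n g
  ⋁Sub-ub zero    g []          = refl
  ⋁Sub-ub (suc n) g (false ∷ I) = trans (⋁Sub-ub n (g ∘ (false ∷_)) I) ∨-ub₁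
  ⋁Sub-ub (suc n) g (true ∷ I)  = trans (⋁Sub-ub n (g ∘ (true ∷_)) I) ∨-ub₂

  sumSub-∅ : ∀ {n} (S : Simple n) → sumSub S ∅ ≡ 0ℚ
  sumSub-∅ []      = refl
  sumSub-∅ (_ ∷ S) = sumSub-∅ S

  meetSub-∅ : ∀ {n} (S : Simple n) → meetSub S ∅ ≡ ⊤
  meetSub-∅ []      = refl
  meetSub-∅ (_ ∷ S) = meetSub-∅ S

  module _ (f : Carrier) where

    lowerSum upperSum : ∀ {n} → (Fin (suc n) → ℚ) → Simple n
    lowerSum {n} s = tabulate (λ (i : Fin n) → (s (inject₁ i) , ⟨ s (inject₁ i) < f < s (suc i) ⟩))
    upperSum {n} s = tabulate (λ (i : Fin n) → (s (suc i) , ⟨ s (inject₁ i) ≤ f ≤ s (suc i) ⟩))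

    cover : ∀ {n} → Simple n → BTerm
    cover {n} S = ⋁Sub n (λ J → (f ≤ᵇ sumSub S J) ∧ᴮ meetSub S J)

    head-≤-cover : ∀ {n} r x (S : Simple n) → (f ≤ᵇ r) ∧ᴮ x ≤ᴮ cover ((r , x) ∷ S)
    head-≤-cover {n} r x S = trans (∧-glb ≤[f≤r] ≤[x∧∅]) (trans (⋁Sub-ub n _ ∅) ∨-ub₂)
      where
      ≤[f≤r] : (f ≤ᵇ r) ∧ᴮ x ≤ᴮ f ≤ᵇ (r +ℚ sumSub S ∅)
      ≤[f≤r] = subst (λ q → _ ≤ᴮ f ≤ᵇ q)
                  (sym (≡.trans (cong (r +ℚ_) (sumSub-∅ S)) (ℚ.+-identityʳ r))) ∧-lb₁
      ≤[x∧∅] : (f ≤ᵇ r) ∧ᴮ x ≤ᴮ x ∧ᴮ meetSub S ∅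
      ≤[x∧∅] = ∧-glb ∧-lb₂ (subst (_ ≤ᴮ_) (sym (meetSub-∅ S)) ⊤-max)

    cover-tail : ∀ {n} r x (S : Simple n) → cover S ≤ᴮ cover ((r , x) ∷ S)
    cover-tail r x S = ∨-ub₁

    lowerSum-∅⊎>head : ∀ {n} (s : Fin (suc n) → ℚ) → Ascending s → ∀ I →
      sumSub (lowerSum s) I ≡ 0ℚ ⊎ meetSub (lowerSum s) I ≤ᴮ f >ᵇ s zero
    lowerSum-∅⊎>head s asc []          = inj₁ refl
    lowerSum-∅⊎>head s asc (true ∷ I)  = inj₂ (trans ∧-lb₁ ∧-lb₁)
    lowerSum-∅⊎>head s asc (false ∷ I) =
      map₂ (λ m → trans m (>ᵇ-antitone f (asc zero))) (lowerSum-∅⊎>head (s ∘ suc) (asc ∘ suc) I)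

    lowerSum-≼ : ⊤ ≤ᴮ 0ℚ ≤ᵇ' f → ∀ {n} (s : Fin (suc n) → ℚ) → Ascending s → lowerSum s ≼ f
    lowerSum-≼ 0≤f s asc []          = 0≤f
    lowerSum-≼ 0≤f s asc (false ∷ I) = lowerSum-≼ 0≤f (s ∘ suc) (asc ∘ suc) I
    lowerSum-≼ 0≤f s asc (true ∷ I) with lowerSum-∅⊎>head (s ∘ suc) (asc ∘ suc) I
    ... | inj₁ rest≡0 =
      subst (λ q → meetSub (lowerSum s) (true ∷ I) ≤ᴮ q ≤ᵇ' f)
            (sym (≡.trans (cong (s zero +ℚ_) rest≡0) (ℚ.+-identityʳ (s zero))))
            (trans ∧-lb₁ (trans ∧-lb₁ (>ᵇ⇒≤ᵇ' f (s zero))))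
    ... | inj₂ rest≤f>s₁ =
      trans (∧-glb (trans ∧-lb₂ rest≤f>s₁) (trans ∧-lb₁ ∧-lb₂))
            (trans (>ᵇ∧<ᵇ≤⊥ f (s (suc zero))) ⊥-min)

    upperSum-cover : ∀ {n} (s : Fin (suc (suc n)) → ℚ) →
      (s zero ≤ᵇ' f) ∧ᴮ (f ≤ᵇ s (fromℕ (suc n))) ≤ᴮ cover (upperSum s)
    upperSum-cover {zero} s =
      trans (∧-glb ∧-lb₂ refl) (head-≤-cover (s (suc zero)) ⟨ s zero ≤ f ≤ s (suc zero) ⟩ [])
    upperSum-cover {suc n} s =
      trans (≤-split (f ≤ᵇ s₁)) (∨-lub (trans case-f≤s₁ (head-≤-cover s₁ ⟨ s zero ≤ f ≤ s₁ ⟩ tail))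
                                       (trans case-s₁<f (cover-tail s₁ ⟨ s zero ≤ f ≤ s₁ ⟩ tail)))
      where
      s₁ : ℚ
      s₁ = s (suc zero)
      tail : Simple (suc n)
      tail = upperSum (s ∘ suc)
      sₙ : ℚ
      sₙ = s (fromℕ (suc (suc n)))
      case-f≤s₁ : ((s zero ≤ᵇ' f) ∧ᴮ (f ≤ᵇ sₙ)) ∧ᴮ (f ≤ᵇ s₁) ≤ᴮ (f ≤ᵇ s₁) ∧ᴮ ⟨ s zero ≤ f ≤ s₁ ⟩
      case-f≤s₁ = ∧-glb ∧-lb₂ (∧-glb (trans ∧-lb₁ ∧-lb₁) ∧-lb₂)
      case-s₁<f : ((s zero ≤ᵇ' f) ∧ᴮ (f ≤ᵇ sₙ)) ∧ᴮ ¬ (f ≤ᵇ s₁) ≤ᴮ cover tail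
      case-s₁<f = trans (∧-glb (trans ∧-lb₂ (trans ¬¬-elim (>ᵇ⇒≤ᵇ' f s₁))) (trans ∧-lb₁ ∧-lb₂))
                   (upperSum-cover (s ∘ suc))

lemma4p10 : ∀ {a} (R : RieszSpace a) → let open Spec R in
    (f : Carrier) (b : ℚ) → 0# ≤ f → f ≤ ⟦ b ⟧ →
    (n : ℕ) (s : Fin (suc n) → ℚ) → s zero ≡ 0ℚ → s (fromℕ n) ≡ b →
    (∀ (i : Fin n) → s (inject₁ i) < s (suc i)) →
    (tabulate (λ (i : Fin n) → (s (inject₁ i) , ⟨ s (inject₁ i) < f < s (suc i) ⟩)) ≼ f)
    × (f ≼' tabulate (λ (i : Fin n) → (s (suc i) , ⟨ s (inject₁ i) ≤ f ≤ s (suc i) ⟩)))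
lemma4p10 R f b 0≤f f≤⟦b⟧ n s s₀≡0 sₙ≡b s-increasing =
  lowerSum-≼ f ⊤≤[0≤f] s (ℚ.<⇒≤ ∘ s-increasing) , upper n s s₀≡0 sₙ≡b
  where
  open Spec R
  open Properties R
  ⊤≤[0≤f] : ⊤ ≤ᴮ 0ℚ ≤ᵇ' f
  ⊤≤[0≤f] = x≤y⇒⊤≤¬D[x-y] (subst (_≤ f) (sym (·-zeroˡ 𝟙)) 0≤f)
  ⊤≤[f≤b] : ⊤ ≤ᴮ f ≤ᵇ b
  ⊤≤[f≤b] = x≤y⇒⊤≤¬D[x-y] f≤⟦b⟧
  upper : ∀ n (s : Fin (suc n) → ℚ) → s zero ≡ 0ℚ → s (fromℕ n) ≡ b → f ≼' upperSum f s
  -- With n = 0 both sums are empty, and the upper one reads f ≤ 0 = s₀ = b.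
  upper zero    s s₀≡0 sₙ≡b = ∧-glb (subst (λ q → ⊤ ≤ᴮ f ≤ᵇ q) (≡.trans (sym sₙ≡b) s₀≡0) ⊤≤[f≤b]) refl
  upper (suc n) s s₀≡0 sₙ≡b =
    trans (∧-glb (subst (λ q → ⊤ ≤ᴮ q ≤ᵇ' f) (sym s₀≡0) ⊤≤[0≤f])
                 (subst (λ q → ⊤ ≤ᴮ f ≤ᵇ q) (sym sₙ≡b) ⊤≤[f≤b]))
          (upperSum-cover f s)
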